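{- Every $\mathbf{FinSet}$-recognizable language of $\lambda$-terms is syntactically recognizable: for every simple type $A$, finite set $Q$ and subset $F\subseteq[\![A]\!]_Q$, there exist a simple type $B$ and a closed term $r\in\mathrm{Tm}(A[B]\to\mathrm{Bool})$ such that $\{t\in\mathrm{Tm}(A)\mid[\![t]\!]_Q\in F\} = \{t\in\mathrm{Tm}(A)\mid r\ t[B]=_{\beta\eta}\mathsf{true}\}$.
   Context: Simple types: $A ::= o \mid A\to B \mid A\times B \mid 1$; $\mathrm{Tm}(A)$ is the set of closed simply typed $\lambda$-terms (with type-annotated abstractions, pairs, projections, unit) of type $A$ modulo $\beta\eta$. For a finite set $Q$, $[\![A]\!]_Q$ is the set-theoretic interpretation: $[\![o]\!]_Q=Q$, $[\![A\to B]\!]_Q$ the set of functions, $[\![A\times B]\!]_Q$ the cartesian product, $[\![1]\!]_Q$ a singleton, and $[\![t]\!]_Q\in[\![A]\!]_Q$ is the standard set-theoretic denotation of $t$. $A[B]$ is $A$ with every occurrence of $o$ replaced by $B$, and $t[B]$ is $t$ with every type annotation $A'$ replaced by $A'[B]$ (so $t[B]\in\mathrm{Tm}(A[B])$). $\mathrm{Bool}:=o\times o\to o$ and $\mathsf{true}:=\lambda(x:o\times o).\,x_1$. -}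

module Defs where

open import Data.Nat using (ℕ)
open import Data.Fin using (Fin)
open import Data.Unit using (⊤; tt)
open import Data.Product using (_×_; _,_; proj₁; proj₂)
open import Relation.Binary.PropositionalEquality using (_≡_)

infixr 7 _⇒_
infixr 8 _⊗_

data Ty : Set where
  o   : Ty
  _⇒_ : Ty → Ty → Ty
  _⊗_ : Ty → Ty → Ty
  𝟙   : Ty

-- Contexts, variables, intrinsically typed terms (de Bruijn).
-- The type annotation of an abstraction is the index A of 'lam'.

infixl 5 _▸_

data Ctx : Set where
  ∅   : Ctx
  _▸_ : Ctx → Ty → Ctx

data Var : Ctx → Ty → Set where
  vz : ∀ {Γ A} → Var (Γ ▸ A) A
  vs : ∀ {Γ A B} → Var Γ A → Var (Γ ▸ B) A

data Tm (Γ : Ctx) : Ty → Set where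
  var  : ∀ {A} → Var Γ A → Tm Γ A
  lam  : ∀ {A B} → Tm (Γ ▸ A) B → Tm Γ (A ⇒ B)
  app  : ∀ {A B} → Tm Γ (A ⇒ B) → Tm Γ A → Tm Γ B
  pair : ∀ {A B} → Tm Γ A → Tm Γ B → Tm Γ (A ⊗ B)
  fst  : ∀ {A B} → Tm Γ (A ⊗ B) → Tm Γ A
  snd  : ∀ {A B} → Tm Γ (A ⊗ B) → Tm Γ B
  unit : Tm Γ 𝟙

Ren : Ctx → Ctx → Set
Ren Γ Δ = ∀ {A} → Var Γ A → Var Δ A

liftR : ∀ {Γ Δ B} → Ren Γ Δ → Ren (Γ ▸ B) (Δ ▸ B)
liftR ρ vz     = vz
liftR ρ (vs x) = vs (ρ x)

ren : ∀ {Γ Δ A} → Ren Γ Δ → Tm Γ A → Tm Δ A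
ren ρ (var x)    = var (ρ x)
ren ρ (lam t)    = lam (ren (liftR ρ) t)
ren ρ (app t u)  = app (ren ρ t) (ren ρ u)
ren ρ (pair t u) = pair (ren ρ t) (ren ρ u)
ren ρ (fst t)    = fst (ren ρ t)
ren ρ (snd t)    = snd (ren ρ t)
ren ρ unit       = unit

wk : ∀ {Γ A B} → Tm Γ A → Tm (Γ ▸ B) A
wk = ren vs

Sub : Ctx → Ctx → Set
Sub Γ Δ = ∀ {A} → Var Γ A → Tm Δ A

liftS : ∀ {Γ Δ B} → Sub Γ Δ → Sub (Γ ▸ B) (Δ ▸ B)
liftS σ vz     = var vz
liftS σ (vs x) = wk (σ x)

sub : ∀ {Γ Δ A} → Sub Γ Δ → Tm Γ A → Tm Δ A
sub σ (var x)    = σ x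
sub σ (lam t)    = lam (sub (liftS σ) t)
sub σ (app t u)  = app (sub σ t) (sub σ u)
sub σ (pair t u) = pair (sub σ t) (sub σ u)
sub σ (fst t)    = fst (sub σ t)
sub σ (snd t)    = snd (sub σ t)
sub σ unit       = unit

sub0 : ∀ {Γ A B} → Tm (Γ ▸ A) B → Tm Γ A → Tm Γ B
sub0 {Γ} {A} t u = sub σ t
  where
  σ : Sub (Γ ▸ A) Γ
  σ vz     = u
  σ (vs x) = var x

infix 4 _≈βη_

data _≈βη_ {Γ : Ctx} : ∀ {A} → Tm Γ A → Tm Γ A → Set where
  ≈refl  : ∀ {A} {t : Tm Γ A} → t ≈βη t
  ≈sym   : ∀ {A} {t u : Tm Γ A} → t ≈βη u → u ≈βη t
  ≈trans : ∀ {A} {t u v : Tm Γ A} → t ≈βη u → u ≈βη v → t ≈βη v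
  ≈lam   : ∀ {A B} {t u : Tm (Γ ▸ A) B} → t ≈βη u → lam t ≈βη lam u
  ≈app   : ∀ {A B} {t t' : Tm Γ (A ⇒ B)} {u u' : Tm Γ A} →
           t ≈βη t' → u ≈βη u' → app t u ≈βη app t' u'
  ≈pair  : ∀ {A B} {t t' : Tm Γ A} {u u' : Tm Γ B} →
           t ≈βη t' → u ≈βη u' → pair t u ≈βη pair t' u'
  ≈fst   : ∀ {A B} {t t' : Tm Γ (A ⊗ B)} → t ≈βη t' → fst t ≈βη fst t'
  ≈snd   : ∀ {A B} {t t' : Tm Γ (A ⊗ B)} → t ≈βη t' → snd t ≈βη snd t'
  β⇒     : ∀ {A B} (t : Tm (Γ ▸ A) B) (u : Tm Γ A) → app (lam t) u ≈βη sub0 t u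
  η⇒     : ∀ {A B} (t : Tm Γ (A ⇒ B)) → t ≈βη lam (app (wk t) (var vz))
  β⊗₁    : ∀ {A B} (t : Tm Γ A) (u : Tm Γ B) → fst (pair t u) ≈βη t
  β⊗₂    : ∀ {A B} (t : Tm Γ A) (u : Tm Γ B) → snd (pair t u) ≈βη u
  η⊗     : ∀ {A B} (t : Tm Γ (A ⊗ B)) → t ≈βη pair (fst t) (snd t)
  η𝟙     : (t : Tm Γ 𝟙) → t ≈βη unit

_[_]ᵀ : Ty → Ty → Ty
o       [ B ]ᵀ = B
(A ⇒ C) [ B ]ᵀ = A [ B ]ᵀ ⇒ C [ B ]ᵀ
(A ⊗ C) [ B ]ᵀ = A [ B ]ᵀ ⊗ C [ B ]ᵀ
𝟙       [ B ]ᵀ = 𝟙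

_[_]ᶜ : Ctx → Ty → Ctx
∅       [ B ]ᶜ = ∅
(Γ ▸ A) [ B ]ᶜ = Γ [ B ]ᶜ ▸ A [ B ]ᵀ

_[_]ⱽ : ∀ {Γ A} → Var Γ A → (B : Ty) → Var (Γ [ B ]ᶜ) (A [ B ]ᵀ)
vz   [ B ]ⱽ = vz
vs x [ B ]ⱽ = vs (x [ B ]ⱽ)

_[_]ᵗ : ∀ {Γ A} → Tm Γ A → (B : Ty) → Tm (Γ [ B ]ᶜ) (A [ B ]ᵀ)
var x    [ B ]ᵗ = var (x [ B ]ⱽ)
lam t    [ B ]ᵗ = lam (t [ B ]ᵗ)
app t u  [ B ]ᵗ = app (t [ B ]ᵗ) (u [ B ]ᵗ)
pair t u [ B ]ᵗ = pair (t [ B ]ᵗ) (u [ B ]ᵗ)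
fst t    [ B ]ᵗ = fst (t [ B ]ᵗ)
snd t    [ B ]ᵗ = snd (t [ B ]ᵗ)
unit     [ B ]ᵗ = unit

BoolTy : Ty
BoolTy = o ⊗ o ⇒ o

trueTm : Tm ∅ BoolTy
trueTm = lam (fst (var vz))

⟦_⟧ : Ty → ℕ → Set
⟦ o ⟧     n = Fin n
⟦ A ⇒ B ⟧ n = ⟦ A ⟧ n → ⟦ B ⟧ n
⟦ A ⊗ B ⟧ n = ⟦ A ⟧ n × ⟦ B ⟧ n
⟦ 𝟙 ⟧     n = ⊤

⟦_⟧ᶜ : Ctx → ℕ → Set
⟦ ∅ ⟧ᶜ     n = ⊤
⟦ Γ ▸ A ⟧ᶜ n = ⟦ Γ ⟧ᶜ n × ⟦ A ⟧ n

lookupV : ∀ {n Γ A} → Var Γ A → ⟦ Γ ⟧ᶜ n → ⟦ A ⟧ n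
lookupV vz     (γ , a) = a
lookupV (vs x) (γ , a) = lookupV x γ

eval : ∀ {n Γ A} → Tm Γ A → ⟦ Γ ⟧ᶜ n → ⟦ A ⟧ n
eval (var x)    γ = lookupV x γ
eval (lam t)    γ = λ a → eval t (γ , a)
eval (app t u)  γ = eval t γ (eval u γ)
eval (pair t u) γ = eval t γ , eval u γ
eval (fst t)    γ = proj₁ (eval t γ)
eval (snd t)    γ = proj₂ (eval t γ)
eval unit       γ = tt

⟦_⟧ᵗ : ∀ {A} → Tm ∅ A → (n : ℕ) → ⟦ A ⟧ n
⟦ t ⟧ᵗ n = eval t tt

-- Extensional equality of semantic values (logical relation).  In set
-- theory functions are extensional; since Agda lacks funext, a
-- "subset F" must be a predicate that respects this equality.

SemEq : ∀ {n} (A : Ty) → ⟦ A ⟧ n → ⟦ A ⟧ n → Set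
SemEq o       x y = x ≡ y
SemEq (A ⇒ B) f g = ∀ x y → SemEq A x y → SemEq B (f x) (g y)
SemEq (A ⊗ B) p q = SemEq A (proj₁ p) (proj₁ q) × SemEq B (proj₂ p) (proj₂ q)
SemEq 𝟙       _ _ = ⊤

-- Take B := oⁿ → o for |Q| = n, so that the closed terms λv. vᵢ encode the elements of Q.  A
-- logical relation between Tm(A[B]) and ⟦A⟧_Q, relating λv. vᵢ to i at o, holds between t[B] and
-- ⟦t⟧_Q for every closed t.  Since ⟦A⟧_Q is finite, the characteristic function of F is defined by
-- a term χ that is polymorphic in o: given the elements of Q and a case distinction on o as
-- parameters, it computes the code of the index of its argument in an enumeration of ⟦A⟧_Q and
-- looks the answer up in a table.  That χ is correct is checked in the set-theoretic model;
-- instantiating o := B and the parameters by the codes and a syntactic case distinction gives r,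
-- which is correct by the logical relation.  For |Q| ≤ 1 the predicate F is constant, and r is a
-- constant function.  Finally true ≠ false, as they denote different values in the model |Q| = 2.

module Submission where

open import Defs
open import Data.Nat using (ℕ; zero; suc; _*_; _^_)
open import Data.Fin using (Fin; zero; suc; combine; remQuot; funToFin; finToFun)
open import Data.Fin.Properties using (¬Fin0; remQuot-combine; finToFun-funToFin)
open import Data.Bool using (Bool; true; false)
open import Data.Unit using (⊤; tt)
open import Data.Empty using (⊥; ⊥-elim)
open import Data.Product using (Σ; _×_; _,_; proj₁; proj₂)
open import Relation.Nullary using (Dec; yes; no)
open import Relation.Binary.PropositionalEquality
open import Function.Bundles using (_⇔_; mk⇔)

private
  variable
    k m : ℕ
    Γ Δ Θ : Ctx
    A C T Z W : Ty

ren-ren : (ρ : Ren Γ Δ) (ρ' : Ren Δ Θ) (ρ'' : Ren Γ Θ) →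
          (∀ {B} (x : Var Γ B) → ρ' (ρ x) ≡ ρ'' x) →
          (t : Tm Γ A) → ren ρ' (ren ρ t) ≡ ren ρ'' t
ren-ren ρ ρ' ρ'' h (var x)    = cong var (h x)
ren-ren {Γ = Γ} ρ ρ' ρ'' h (lam {A = C} t) =
  cong lam (ren-ren (liftR ρ) (liftR ρ') (liftR ρ'') h↑ t)
  where
  h↑ : ∀ {B} (x : Var (Γ ▸ C) B) → liftR ρ' (liftR ρ x) ≡ liftR ρ'' x
  h↑ vz     = refl
  h↑ (vs x) = cong vs (h x)
ren-ren ρ ρ' ρ'' h (app t u)  = cong₂ app (ren-ren ρ ρ' ρ'' h t) (ren-ren ρ ρ' ρ'' h u)
ren-ren ρ ρ' ρ'' h (pair t u) = cong₂ pair (ren-ren ρ ρ' ρ'' h t) (ren-ren ρ ρ' ρ'' h u)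
ren-ren ρ ρ' ρ'' h (fst t)    = cong fst (ren-ren ρ ρ' ρ'' h t)
ren-ren ρ ρ' ρ'' h (snd t)    = cong snd (ren-ren ρ ρ' ρ'' h t)
ren-ren ρ ρ' ρ'' h unit       = refl

sub-ren : (ρ : Ren Γ Δ) (σ : Sub Δ Θ) (σ' : Sub Γ Θ) →
          (∀ {B} (x : Var Γ B) → σ (ρ x) ≡ σ' x) →
          (t : Tm Γ A) → sub σ (ren ρ t) ≡ sub σ' t
sub-ren ρ σ σ' h (var x)    = h x
sub-ren {Γ = Γ} ρ σ σ' h (lam {A = C} t) =
  cong lam (sub-ren (liftR ρ) (liftS σ) (liftS σ') h↑ t)
  where
  h↑ : ∀ {B} (x : Var (Γ ▸ C) B) → liftS σ (liftR ρ x) ≡ liftS σ' x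
  h↑ vz     = refl
  h↑ (vs x) = cong wk (h x)
sub-ren ρ σ σ' h (app t u)  = cong₂ app (sub-ren ρ σ σ' h t) (sub-ren ρ σ σ' h u)
sub-ren ρ σ σ' h (pair t u) = cong₂ pair (sub-ren ρ σ σ' h t) (sub-ren ρ σ σ' h u)
sub-ren ρ σ σ' h (fst t)    = cong fst (sub-ren ρ σ σ' h t)
sub-ren ρ σ σ' h (snd t)    = cong snd (sub-ren ρ σ σ' h t)
sub-ren ρ σ σ' h unit       = refl

ren-sub : (σ : Sub Γ Δ) (ρ : Ren Δ Θ) (σ' : Sub Γ Θ) →
          (∀ {B} (x : Var Γ B) → ren ρ (σ x) ≡ σ' x) →
          (t : Tm Γ A) → ren ρ (sub σ t) ≡ sub σ' t
ren-sub σ ρ σ' h (var x)    = h x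
ren-sub {Γ = Γ} σ ρ σ' h (lam {A = C} t) =
  cong lam (ren-sub (liftS σ) (liftR ρ) (liftS σ') h↑ t)
  where
  h↑ : ∀ {B} (x : Var (Γ ▸ C) B) → ren (liftR ρ) (liftS σ x) ≡ liftS σ' x
  h↑ vz     = refl
  h↑ (vs x) = begin
    ren (liftR ρ) (wk (σ x))   ≡⟨ ren-ren vs (liftR ρ) (λ y → vs (ρ y)) (λ _ → refl) (σ x) ⟩
    ren (λ y → vs (ρ y)) (σ x) ≡⟨ ren-ren ρ vs (λ y → vs (ρ y)) (λ _ → refl) (σ x) ⟨
    wk (ren ρ (σ x))           ≡⟨ cong wk (h x) ⟩
    wk (σ' x)                  ∎
    where open ≡-Reasoning
ren-sub σ ρ σ' h (app t u)  = cong₂ app (ren-sub σ ρ σ' h t) (ren-sub σ ρ σ' h u)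
ren-sub σ ρ σ' h (pair t u) = cong₂ pair (ren-sub σ ρ σ' h t) (ren-sub σ ρ σ' h u)
ren-sub σ ρ σ' h (fst t)    = cong fst (ren-sub σ ρ σ' h t)
ren-sub σ ρ σ' h (snd t)    = cong snd (ren-sub σ ρ σ' h t)
ren-sub σ ρ σ' h unit       = refl

sub-sub : (σ : Sub Γ Δ) (τ : Sub Δ Θ) (σ' : Sub Γ Θ) →
          (∀ {B} (x : Var Γ B) → sub τ (σ x) ≡ σ' x) →
          (t : Tm Γ A) → sub τ (sub σ t) ≡ sub σ' t
sub-sub σ τ σ' h (var x)    = h x
sub-sub {Γ = Γ} σ τ σ' h (lam {A = C} t) =
  cong lam (sub-sub (liftS σ) (liftS τ) (liftS σ') h↑ t)
  where
  h↑ : ∀ {B} (x : Var (Γ ▸ C) B) → sub (liftS τ) (liftS σ x) ≡ liftS σ' x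
  h↑ vz     = refl
  h↑ (vs x) = begin
    sub (liftS τ) (wk (σ x))   ≡⟨ sub-ren vs (liftS τ) (λ y → wk (τ y)) (λ _ → refl) (σ x) ⟩
    sub (λ y → wk (τ y)) (σ x) ≡⟨ ren-sub τ vs (λ y → wk (τ y)) (λ _ → refl) (σ x) ⟨
    wk (sub τ (σ x))           ≡⟨ cong wk (h x) ⟩
    wk (σ' x)                  ∎
    where open ≡-Reasoning
sub-sub σ τ σ' h (app t u)  = cong₂ app (sub-sub σ τ σ' h t) (sub-sub σ τ σ' h u)
sub-sub σ τ σ' h (pair t u) = cong₂ pair (sub-sub σ τ σ' h t) (sub-sub σ τ σ' h u)
sub-sub σ τ σ' h (fst t)    = cong fst (sub-sub σ τ σ' h t)
sub-sub σ τ σ' h (snd t)    = cong snd (sub-sub σ τ σ' h t)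
sub-sub σ τ σ' h unit       = refl

sub-id : (σ : Sub Γ Γ) → (∀ {B} (x : Var Γ B) → σ x ≡ var x) → (t : Tm Γ A) → sub σ t ≡ t
sub-id σ h (var x)    = h x
sub-id {Γ = Γ} σ h (lam {A = C} t) = cong lam (sub-id (liftS σ) h↑ t)
  where
  h↑ : ∀ {B} (x : Var (Γ ▸ C) B) → liftS σ x ≡ var x
  h↑ vz     = refl
  h↑ (vs x) = cong wk (h x)
sub-id σ h (app t u)  = cong₂ app (sub-id σ h t) (sub-id σ h u)
sub-id σ h (pair t u) = cong₂ pair (sub-id σ h t) (sub-id σ h u)
sub-id σ h (fst t)    = cong fst (sub-id σ h t)
sub-id σ h (snd t)    = cong snd (sub-id σ h t)
sub-id σ h unit       = refl

sub-var : (t : Tm Γ A) → sub var t ≡ t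
sub-var = sub-id var (λ _ → refl)

sub-cong : (σ σ' : Sub Γ Δ) → (∀ {B} (x : Var Γ B) → σ x ≡ σ' x) →
           (t : Tm Γ A) → sub σ t ≡ sub σ' t
sub-cong σ σ' h t =
  trans (sym (sub-var (sub σ t))) (sub-sub σ var σ' (λ x → trans (sub-var (σ x)) (h x)) t)

extS : Sub Γ Δ → Tm Δ A → Sub (Γ ▸ A) Δ
extS σ u vz     = u
extS σ u (vs x) = σ x

sub0≡sub-extS : (t : Tm (Γ ▸ A) C) (u : Tm Γ A) → sub0 t u ≡ sub (extS var u) t
sub0≡sub-extS t u = sub-cong _ (extS var u) (λ { vz → refl ; (vs x) → refl }) t

sub-extS-wk : (t : Tm Γ A) (u : Tm Γ C) → sub (extS var u) (wk t) ≡ t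
sub-extS-wk t u = trans (sub-ren vs _ var (λ _ → refl) t) (sub-var t)

sub0-liftS : (σ : Sub Γ Δ) (t : Tm (Γ ▸ A) C) (u : Tm Δ A) →
             sub0 (sub (liftS σ) t) u ≡ sub (extS σ u) t
sub0-liftS σ t u =
  trans (sub0≡sub-extS (sub (liftS σ) t) u) (sub-sub (liftS σ) (extS var u) (extS σ u) h t)
  where
  h : ∀ {B} (x : Var _ B) → sub (extS var u) (liftS σ x) ≡ extS σ u x
  h vz     = refl
  h (vs x) = sub-extS-wk (σ x) u

≡⇒≈βη : {t u : Tm Γ A} → t ≡ u → t ≈βη u
≡⇒≈βη refl = ≈refl

β-extS : (t : Tm (Γ ▸ A) C) (u : Tm Γ A) → app (lam t) u ≈βη sub (extS var u) t
β-extS t u = ≈trans (β⇒ t u) (≡⇒≈βη (sub0≡sub-extS t u))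

β-wk : (t : Tm Γ C) (u : Tm Γ A) → app (lam (wk t)) u ≈βη t
β-wk t u = ≈trans (β-extS (wk t) u) (≡⇒≈βη (sub-extS-wk t u))

SemEq-sym : ∀ {n} A {x y : ⟦ A ⟧ n} → SemEq A x y → SemEq A y x
SemEq-sym o       e         = sym e
SemEq-sym (A ⇒ C) h a b ab  = SemEq-sym C (h b a (SemEq-sym A ab))
SemEq-sym (A ⊗ C) (e₁ , e₂) = SemEq-sym A e₁ , SemEq-sym C e₂
SemEq-sym 𝟙       _         = tt

SemEq-trans : ∀ {n} A {x y z : ⟦ A ⟧ n} → SemEq A x y → SemEq A y z → SemEq A x z
SemEq-trans o       e e' = trans e e'
SemEq-trans (A ⇒ C) h h' a b ab =
  SemEq-trans C (h a b ab) (h' b b (SemEq-trans A (SemEq-sym A ab) ab))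
SemEq-trans (A ⊗ C) (e₁ , e₂) (e₁' , e₂') = SemEq-trans A e₁ e₁' , SemEq-trans C e₂ e₂'
SemEq-trans 𝟙       _ _ = tt

SemEq-reflˡ : ∀ {n} A {x y : ⟦ A ⟧ n} → SemEq A x y → SemEq A x x
SemEq-reflˡ A e = SemEq-trans A e (SemEq-sym A e)

SemEq-reflʳ : ∀ {n} A {x y : ⟦ A ⟧ n} → SemEq A x y → SemEq A y y
SemEq-reflʳ A e = SemEq-trans A (SemEq-sym A e) e

SemEq-subsingleton : ∀ {n} → (∀ (x y : Fin n) → x ≡ y) → ∀ A (x y : ⟦ A ⟧ n) → SemEq A x y
SemEq-subsingleton h o       x y       = h x y
SemEq-subsingleton h (A ⇒ C) f g x y _ = SemEq-subsingleton h C (f x) (g y)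
SemEq-subsingleton h (A ⊗ C) p q       = SemEq-subsingleton h A _ _ , SemEq-subsingleton h C _ _
SemEq-subsingleton h 𝟙       _ _       = tt

EnvRel : ∀ {n} → Ren Γ Δ → ⟦ Γ ⟧ᶜ n → ⟦ Δ ⟧ᶜ n → Set
EnvRel {Γ = Γ} ρ δ γ = ∀ {B} (x : Var Γ B) → SemEq B (lookupV x δ) (lookupV (ρ x) γ)

EnvEq : ∀ {n} → ⟦ Γ ⟧ᶜ n → ⟦ Γ ⟧ᶜ n → Set
EnvEq = EnvRel (λ x → x)

EnvEq-sym : ∀ {n} {δ γ : ⟦ Γ ⟧ᶜ n} → EnvEq δ γ → EnvEq γ δ
EnvEq-sym h x = SemEq-sym _ (h x)

EnvEq-reflʳ : ∀ {n} {δ γ : ⟦ Γ ⟧ᶜ n} → EnvEq δ γ → EnvEq γ γ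
EnvEq-reflʳ h x = SemEq-reflʳ _ (h x)

eval-ren : ∀ {n} (ρ : Ren Γ Δ) (t : Tm Γ A) (δ : ⟦ Γ ⟧ᶜ n) (γ : ⟦ Δ ⟧ᶜ n) →
           EnvRel ρ δ γ → SemEq A (eval t δ) (eval (ren ρ t) γ)
eval-ren ρ (var x)    δ γ h = h x
eval-ren ρ (lam t)    δ γ h a b ab =
  eval-ren (liftR ρ) t (δ , a) (γ , b) (λ { vz → ab ; (vs x) → h x })
eval-ren ρ (app t u)  δ γ h = eval-ren ρ t δ γ h _ _ (eval-ren ρ u δ γ h)
eval-ren ρ (pair t u) δ γ h = eval-ren ρ t δ γ h , eval-ren ρ u δ γ h
eval-ren ρ (fst t)    δ γ h = proj₁ (eval-ren ρ t δ γ h)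
eval-ren ρ (snd t)    δ γ h = proj₂ (eval-ren ρ t δ γ h)
eval-ren ρ unit       δ γ h = tt

eval-SemEq : ∀ {n} (t : Tm Γ A) (δ γ : ⟦ Γ ⟧ᶜ n) → EnvEq δ γ → SemEq A (eval t δ) (eval t γ)
eval-SemEq (var x)    δ γ h = h x
eval-SemEq (lam t)    δ γ h a b ab = eval-SemEq t (δ , a) (γ , b) (λ { vz → ab ; (vs x) → h x })
eval-SemEq (app t u)  δ γ h = eval-SemEq t δ γ h _ _ (eval-SemEq u δ γ h)
eval-SemEq (pair t u) δ γ h = eval-SemEq t δ γ h , eval-SemEq u δ γ h
eval-SemEq (fst t)    δ γ h = proj₁ (eval-SemEq t δ γ h)
eval-SemEq (snd t)    δ γ h = proj₂ (eval-SemEq t δ γ h)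
eval-SemEq unit       δ γ h = tt

eval-sub : ∀ {n} (σ : Sub Γ Δ) (t : Tm Γ A) (δ : ⟦ Γ ⟧ᶜ n) (γ : ⟦ Δ ⟧ᶜ n) → EnvEq γ γ →
           (∀ {B} (x : Var Γ B) → SemEq B (lookupV x δ) (eval (σ x) γ)) →
           SemEq A (eval t δ) (eval (sub σ t) γ)
eval-sub σ (var x) δ γ hγ h = h x
eval-sub {Γ = Γ} {Δ = Δ} σ (lam {A = C} t) δ γ hγ h a b ab =
  eval-sub (liftS σ) t (δ , a) (γ , b) hγ↑ h↑
  where
  hγ↑ : EnvEq {Γ = Δ ▸ C} (γ , b) (γ , b)
  hγ↑ vz     = SemEq-reflʳ C ab
  hγ↑ (vs x) = hγ x
  h↑ : ∀ {B} (x : Var (Γ ▸ C) B) → SemEq B (lookupV x (δ , a)) (eval (liftS σ x) (γ , b))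
  h↑ vz     = ab
  h↑ (vs x) = SemEq-trans _ (h x) (eval-ren vs (σ x) γ (γ , b) hγ)
eval-sub σ (app t u)  δ γ hγ h = eval-sub σ t δ γ hγ h _ _ (eval-sub σ u δ γ hγ h)
eval-sub σ (pair t u) δ γ hγ h = eval-sub σ t δ γ hγ h , eval-sub σ u δ γ hγ h
eval-sub σ (fst t)    δ γ hγ h = proj₁ (eval-sub σ t δ γ hγ h)
eval-sub σ (snd t)    δ γ hγ h = proj₂ (eval-sub σ t δ γ hγ h)
eval-sub σ unit       δ γ hγ h = tt

eval-≈βη : ∀ {n} {t u : Tm Γ A} → t ≈βη u → (δ γ : ⟦ Γ ⟧ᶜ n) → EnvEq δ γ →
           SemEq A (eval t δ) (eval u γ)
eval-≈βη {t = t} ≈refl δ γ h = eval-SemEq t δ γ h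
eval-≈βη {A = A} (≈sym p) δ γ h = SemEq-sym A (eval-≈βη p γ δ (EnvEq-sym h))
eval-≈βη {A = A} (≈trans p q) δ γ h =
  SemEq-trans A (eval-≈βη p δ γ h) (eval-≈βη q γ γ (EnvEq-reflʳ h))
eval-≈βη (≈lam p)    δ γ h a b ab = eval-≈βη p (δ , a) (γ , b) (λ { vz → ab ; (vs x) → h x })
eval-≈βη (≈app p q)  δ γ h = eval-≈βη p δ γ h _ _ (eval-≈βη q δ γ h)
eval-≈βη (≈pair p q) δ γ h = eval-≈βη p δ γ h , eval-≈βη q δ γ h
eval-≈βη (≈fst p)    δ γ h = proj₁ (eval-≈βη p δ γ h)
eval-≈βη (≈snd p)    δ γ h = proj₂ (eval-≈βη p δ γ h)
eval-≈βη (β⇒ t u)    δ γ h rewrite sub0≡sub-extS t u =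
  eval-sub (extS var u) t (δ , eval u δ) γ (EnvEq-reflʳ h)
    (λ { vz → eval-SemEq u δ γ h ; (vs x) → h x })
eval-≈βη (η⇒ t)      δ γ h a b ab = eval-ren vs t δ (γ , b) h a b ab
eval-≈βη (β⊗₁ t u)   δ γ h = eval-SemEq t δ γ h
eval-≈βη (β⊗₂ t u)   δ γ h = eval-SemEq u δ γ h
eval-≈βη (η⊗ t)      δ γ h = eval-SemEq t δ γ h
eval-≈βη (η𝟙 t)      δ γ h = tt

falseTm : Tm ∅ BoolTy
falseTm = lam (snd (var vz))

trueTm≉falseTm : trueTm ≈βη falseTm → ⊥
trueTm≉falseTm p with eval-≈βη {n = 2} p tt tt (λ ()) (zero , suc zero) (zero , suc zero) (refl , refl)
... | ()

boolTm : Bool → Tm ∅ BoolTy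
boolTm true  = trueTm
boolTm false = falseTm

≡true⇔≈βη-trueTm : {u : Tm ∅ BoolTy} (b : Bool) → u ≈βη boolTm b → (b ≡ true) ⇔ (u ≈βη trueTm)
≡true⇔≈βη-trueTm true  p = mk⇔ (λ _ → p) (λ _ → refl)
≡true⇔≈βη-trueTm false p = mk⇔ (λ ()) (λ q → ⊥-elim (trueTm≉falseTm (≈trans (≈sym q) p)))

Tup : Ty → ℕ → Ty
Tup T zero    = 𝟙
Tup T (suc k) = T ⊗ Tup T k

FinTy : ℕ → Ty
FinTy k = Tup o k ⇒ o

selTm : Fin k → Tm Γ (Tup T k) → Tm Γ T
selTm zero    t = fst t
selTm (suc i) t = selTm i (snd t)

tabTm : (Fin k → Tm Γ T) → Tm Γ (Tup T k)
tabTm {k = zero}  f = unit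
tabTm {k = suc k} f = pair (f zero) (tabTm (λ i → f (suc i)))

finTm : Fin k → Tm Γ (FinTy k)
finTm i = lam (selTm i (var vz))

-- Binding c and bs by a β-redex instead of weakening them keeps the evaluation of the body
-- definitional; enumTm below uses the same device.
caseTm : (T : Ty) → Tm Γ (FinTy k) → Tm Γ (Tup T k) → Tm Γ T
caseTm o       c bs = app c bs
caseTm (Z ⇒ W) c bs =
  app (app (lam (lam (lam (caseTm W (var (vs (vs vz)))
                            (tabTm (λ i → app (selTm i (var (vs vz))) (var vz))))))) c) bs
caseTm (Z ⊗ W) c bs =
  pair (caseTm Z c (tabTm (λ i → fst (selTm i bs)))) (caseTm W c (tabTm (λ i → snd (selTm i bs))))
caseTm 𝟙       c bs = unit

combineTm : Tm Γ (FinTy k) → Tm Γ (FinTy m) → Tm Γ (FinTy (k * m))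
combineTm c d = caseTm _ c (tabTm (λ i → caseTm _ d (tabTm (λ j → finTm (combine i j)))))

funToFinTm : (Fin k → Tm Γ (FinTy m)) → Tm Γ (FinTy (m ^ k))
funToFinTm {k = zero}  f = finTm zero
funToFinTm {k = suc k} f = combineTm (f zero) (funToFinTm (λ i → f (suc i)))

ren-selTm : (ρ : Ren Γ Δ) (i : Fin k) (t : Tm Γ (Tup T k)) → ren ρ (selTm i t) ≡ selTm i (ren ρ t)
ren-selTm ρ zero    t = refl
ren-selTm ρ (suc i) t = ren-selTm ρ i (snd t)

sub-selTm : (σ : Sub Γ Δ) (i : Fin k) (t : Tm Γ (Tup T k)) → sub σ (selTm i t) ≡ selTm i (sub σ t)
sub-selTm σ zero    t = refl
sub-selTm σ (suc i) t = sub-selTm σ i (snd t)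

sub-tabTm : (σ : Sub Γ Δ) (f : Fin k → Tm Γ T) → sub σ (tabTm f) ≡ tabTm (λ i → sub σ (f i))
sub-tabTm {k = zero}  σ f = refl
sub-tabTm {k = suc k} σ f = cong (pair _) (sub-tabTm σ (λ i → f (suc i)))

selTm-cong : (i : Fin k) {t t' : Tm Γ (Tup T k)} → t ≈βη t' → selTm i t ≈βη selTm i t'
selTm-cong zero    p = ≈fst p
selTm-cong (suc i) p = selTm-cong i (≈snd p)

ren-finTm : (ρ : Ren Γ Δ) (i : Fin k) → ren ρ (finTm i) ≡ finTm i
ren-finTm ρ i = cong lam (ren-selTm (liftR ρ) i (var vz))

sub-finTm : (σ : Sub Γ Δ) (i : Fin k) → sub σ (finTm i) ≡ finTm i
sub-finTm σ i = cong lam (sub-selTm (liftS σ) i (var vz))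

finTm-β : (i : Fin k) (v : Tm Γ (Tup o k)) → app (finTm i) v ≈βη selTm i v
finTm-β i v = ≈trans (β-extS (selTm i (var vz)) v) (≡⇒≈βη (sub-selTm (extS var v) i (var vz)))

funToFin-cong : (f g : Fin k → Fin m) → (∀ i → f i ≡ g i) → funToFin f ≡ funToFin g
funToFin-cong {k = zero}  f g h = refl
funToFin-cong {k = suc k} f g h = cong₂ combine (h zero) (funToFin-cong _ _ (λ i → h (suc i)))

module Model (n : ℕ) where

  select : Fin k → ⟦ Tup T k ⟧ n → ⟦ T ⟧ n
  select zero    (x , _)  = x
  select (suc i) (_ , xs) = select i xs

  tabulate : (Fin k → ⟦ T ⟧ n) → ⟦ Tup T k ⟧ n
  tabulate {k = zero}  f = tt
  tabulate {k = suc k} f = f zero , tabulate (λ i → f (suc i))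

  select-tabulate : (f : Fin k → ⟦ T ⟧ n) (i : Fin k) → select i (tabulate f) ≡ f i
  select-tabulate f zero    = refl
  select-tabulate f (suc i) = select-tabulate (λ i → f (suc i)) i

  eval-selTm : (i : Fin k) (t : Tm Γ (Tup T k)) (γ : ⟦ Γ ⟧ᶜ n) →
               eval (selTm i t) γ ≡ select i (eval t γ)
  eval-selTm zero    t γ = refl
  eval-selTm (suc i) t γ = eval-selTm i (snd t) γ

  select-eval-tabTm : (f : Fin k → Tm Γ T) (i : Fin k) (γ : ⟦ Γ ⟧ᶜ n) →
                      select i (eval (tabTm f) γ) ≡ eval (f i) γ
  select-eval-tabTm f zero    γ = refl
  select-eval-tabTm f (suc i) γ = select-eval-tabTm (λ i → f (suc i)) i γ

  ExtEq : ∀ T → ⟦ T ⟧ n → ⟦ T ⟧ n → Set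
  ExtEq o       x y = x ≡ y
  ExtEq (A ⇒ C) f g = ∀ x → ExtEq C (f x) (g x)
  ExtEq (A ⊗ C) p q = ExtEq A (proj₁ p) (proj₁ q) × ExtEq C (proj₂ p) (proj₂ q)
  ExtEq 𝟙       _ _ = ⊤

  ExtEq-SemEq : ∀ A {x y z : ⟦ A ⟧ n} → ExtEq A x y → SemEq A y z → SemEq A x z
  ExtEq-SemEq o       e         e'        = trans e e'
  ExtEq-SemEq (A ⇒ C) e         h x y xy  = ExtEq-SemEq C (e x) (h x y xy)
  ExtEq-SemEq (A ⊗ C) (e₁ , e₂) (h₁ , h₂) = ExtEq-SemEq A e₁ h₁ , ExtEq-SemEq C e₂ h₂
  ExtEq-SemEq 𝟙       _         _         = tt

  infix 4 _codes_
  _codes_ : ⟦ FinTy k ⟧ n → Fin k → Set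
  f codes i = ∀ v → f v ≡ select i v

  eval-caseTm : (T : Ty) (c : Tm Γ (FinTy k)) (bs : Tm Γ (Tup T k)) (γ : ⟦ Γ ⟧ᶜ n) (i : Fin k) →
                eval c γ codes i → ExtEq T (eval (caseTm T c bs) γ) (select i (eval bs γ))
  eval-caseTm o       c bs γ i h = h (eval bs γ)
  eval-caseTm (Z ⇒ W) c bs γ i h z =
    subst (ExtEq W _)
      (trans (select-eval-tabTm _ i δ) (cong-app (eval-selTm i (var (vs vz)) δ) z))
      (eval-caseTm W (var (vs (vs vz))) _ δ i h)
    where
    δ = ((γ , eval c γ) , eval bs γ) , z
  eval-caseTm (Z ⊗ W) c bs γ i h =
    subst (ExtEq Z _) (trans (select-eval-tabTm _ i γ) (cong proj₁ (eval-selTm i bs γ)))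
      (eval-caseTm Z c _ γ i h) ,
    subst (ExtEq W _) (trans (select-eval-tabTm _ i γ) (cong proj₂ (eval-selTm i bs γ)))
      (eval-caseTm W c _ γ i h)
  eval-caseTm 𝟙       c bs γ i h = tt

  finTm-codes : (i : Fin k) (γ : ⟦ Γ ⟧ᶜ n) → eval (finTm i) γ codes i
  finTm-codes i γ v = eval-selTm i (var vz) (γ , v)

  combineTm-codes : (c : Tm Γ (FinTy k)) (d : Tm Γ (FinTy m)) (γ : ⟦ Γ ⟧ᶜ n) {i : Fin k} {j : Fin m} →
                    eval c γ codes i → eval d γ codes j → eval (combineTm c d) γ codes combine i j
  combineTm-codes {k = k} {m = m} c d γ {i} {j} hc hd v = begin
    eval (combineTm c d) γ v              ≡⟨ eval-caseTm _ c (tabTm row) γ i hc v ⟩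
    select i (eval (tabTm row) γ) v       ≡⟨ cong-app (select-eval-tabTm row i γ) v ⟩
    eval (row i) γ v                      ≡⟨ eval-caseTm _ d (tabTm (entry i)) γ j hd v ⟩
    select j (eval (tabTm (entry i)) γ) v ≡⟨ cong-app (select-eval-tabTm (entry i) j γ) v ⟩
    eval (finTm (combine i j)) γ v        ≡⟨ finTm-codes (combine i j) γ v ⟩
    select (combine i j) v                ∎
    where
    open ≡-Reasoning
    entry : Fin k → Fin m → Tm _ (FinTy (k * m))
    entry i j = finTm (combine i j)
    row : Fin k → Tm _ (FinTy (k * m))
    row i = caseTm _ d (tabTm (entry i))

  funToFinTm-codes : (f : Fin k → Tm Γ (FinTy m)) (γ : ⟦ Γ ⟧ᶜ n) (g : Fin k → Fin m) →
                     (∀ i → eval (f i) γ codes g i) → eval (funToFinTm f) γ codes funToFin g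
  funToFinTm-codes {k = zero}  f γ g hf = finTm-codes zero γ
  funToFinTm-codes {k = suc k} f γ g hf =
    combineTm-codes (f zero) (funToFinTm (λ i → f (suc i))) γ (hf zero)
      (funToFinTm-codes (λ i → f (suc i)) γ (λ i → g (suc i)) (λ i → hf (suc i)))

  card : Ty → ℕ
  card o       = n
  card (A ⇒ C) = card C ^ card A
  card (A ⊗ C) = card A * card C
  card 𝟙       = 1

  enum  : ∀ A → Fin (card A) → ⟦ A ⟧ n
  index : ∀ A → ⟦ A ⟧ n → Fin (card A)
  enum o       i   = i
  enum (A ⇒ C) j x = enum C (finToFun {card C} {card A} j (index A x))
  enum (A ⊗ C) j   = enum A (proj₁ (remQuot {card A} (card C) j)) ,
                     enum C (proj₂ (remQuot {card A} (card C) j))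
  enum 𝟙       _   = tt
  index o       x       = x
  index (A ⇒ C) f       = funToFin (λ i → index C (f (enum A i)))
  index (A ⊗ C) (a , c) = combine (index A a) (index C c)
  index 𝟙       _       = zero

  index-cong : ∀ A {x y} → SemEq A x y → index A x ≡ index A y
  enum-refl  : ∀ A i → SemEq A (enum A i) (enum A i)
  index-cong o       e         = e
  index-cong (A ⇒ C) h         =
    funToFin-cong _ _ (λ i → index-cong C (h (enum A i) (enum A i) (enum-refl A i)))
  index-cong (A ⊗ C) (e₁ , e₂) = cong₂ combine (index-cong A e₁) (index-cong C e₂)
  index-cong 𝟙       _         = refl
  enum-refl o       i = refl
  enum-refl (A ⇒ C) j x y xy rewrite index-cong A xy = enum-refl C _
  enum-refl (A ⊗ C) j = enum-refl A _ , enum-refl C _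
  enum-refl 𝟙       _ = tt

  enum-index : ∀ A {x} → SemEq A x x → SemEq A x (enum A (index A x))
  enum-index o       e = refl
  enum-index (A ⇒ C) {f} hf x y xy
    rewrite finToFun-funToFin (λ i → index C (f (enum A i))) (index A y) =
    SemEq-trans C (hf x _ xy') (enum-index C (SemEq-reflʳ C (hf x _ xy')))
    where
    xy' = SemEq-trans A xy (enum-index A (SemEq-reflʳ A xy))
  enum-index (A ⊗ C) {a , c} (e₁ , e₂) =
    subst (λ ij → SemEq A a (enum A (proj₁ ij))) split (enum-index A e₁) ,
    subst (λ ij → SemEq C c (enum C (proj₂ ij))) split (enum-index C e₂)
    where
    split = sym (remQuot-combine {k = card C} (index A a) (index C c))
  enum-index 𝟙       e = tt

  Elements : Tm Γ (Tup o n) → ⟦ Γ ⟧ᶜ n → Set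
  Elements p γ = ∀ i → select i (eval p γ) ≡ i

  Selector : Tm Γ (o ⇒ FinTy n) → ⟦ Γ ⟧ᶜ n → Set
  Selector c γ = ∀ q → eval c γ q codes q

  indexTm : ∀ A → Tm Γ (Tup o n) → Tm Γ (o ⇒ FinTy n) → Tm Γ A → Tm Γ (FinTy (card A))
  enumTm  : ∀ A → Tm Γ (Tup o n) → Tm Γ (o ⇒ FinTy n) → Fin (card A) → Tm Γ A
  indexTm o       p c x = app c x
  indexTm (A ⇒ C) p c x = funToFinTm (λ i → indexTm C p c (app x (enumTm A p c i)))
  indexTm (A ⊗ C) p c x = combineTm (indexTm A p c (fst x)) (indexTm C p c (snd x))
  indexTm 𝟙       p c x = finTm zero
  enumTm o       p c i = selTm i p
  enumTm (A ⇒ C) p c j =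
    app (app (lam (lam (lam (caseTm C (indexTm A (var (vs (vs vz))) (var (vs vz)) (var vz))
      (tabTm (λ i → enumTm C (var (vs (vs vz))) (var (vs vz)) (finToFun {card C} {card A} j i))))))) p) c
  enumTm (A ⊗ C) p c j = pair (enumTm A p c (proj₁ (remQuot {card A} (card C) j)))
                              (enumTm C p c (proj₂ (remQuot {card A} (card C) j)))
  enumTm 𝟙       p c j = unit

  indexTm-codes : ∀ A (p : Tm Γ (Tup o n)) c {γ : ⟦ Γ ⟧ᶜ n} → Elements p γ → Selector c γ →
                  (x : Tm Γ A) → SemEq A (eval x γ) (eval x γ) →
                  eval (indexTm A p c x) γ codes index A (eval x γ)
  eval-enumTm   : ∀ A (p : Tm Γ (Tup o n)) c {γ : ⟦ Γ ⟧ᶜ n} → Elements p γ → Selector c γ →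
                  ∀ j → SemEq A (eval (enumTm A p c j) γ) (enum A j)
  indexTm-codes o       p c hp hc x hx = hc _
  indexTm-codes (A ⇒ C) p c {γ} hp hc x hx =
    funToFinTm-codes _ γ (λ i → index C (eval x γ (enum A i))) λ i →
      subst (eval (indexTm C p c (app x (enumTm A p c i))) γ codes_)
        (index-cong C (hx _ _ (eval-enumTm A p c hp hc i)))
        (indexTm-codes C p c hp hc (app x (enumTm A p c i))
          (hx _ _ (SemEq-reflˡ A (eval-enumTm A p c hp hc i))))
  indexTm-codes (A ⊗ C) p c {γ} hp hc x (h₁ , h₂) =
    combineTm-codes (indexTm A p c (fst x)) (indexTm C p c (snd x)) γ
      (indexTm-codes A p c hp hc (fst x) h₁) (indexTm-codes C p c hp hc (snd x) h₂)
  indexTm-codes 𝟙       p c {γ} hp hc x hx = finTm-codes zero γ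
  eval-enumTm o       p c {γ} hp hc j = trans (eval-selTm j p γ) (hp j)
  eval-enumTm {Γ = Γ} (A ⇒ C) p c {γ} hp hc j x y xy rewrite sym (index-cong A xy) =
    ExtEq-SemEq C
      (eval-caseTm C _ (tabTm branch) δ (index A x)
        (indexTm-codes A p' c' hp hc (var vz) (SemEq-reflˡ A xy)))
      (subst (λ z → SemEq C z (enum C (finToFun j (index A x))))
        (sym (select-eval-tabTm branch (index A x) δ))
        (eval-enumTm C p' c' hp hc (finToFun j (index A x))))
    where
    Γ' = Γ ▸ Tup o n ▸ (o ⇒ FinTy n) ▸ A
    p' : Tm Γ' (Tup o n)
    p' = var (vs (vs vz))
    c' : Tm Γ' (o ⇒ FinTy n)
    c' = var (vs vz)
    δ : ⟦ Γ' ⟧ᶜ n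
    δ = ((γ , eval p γ) , eval c γ) , x
    branch : Fin (card A) → Tm Γ' C
    branch i = enumTm C p' c' (finToFun {card C} {card A} j i)
  eval-enumTm (A ⊗ C) p c hp hc j = eval-enumTm A p c hp hc _ , eval-enumTm C p c hp hc _
  eval-enumTm 𝟙       p c hp hc j = tt

module Realisability (n : ℕ) where
  open Model n

  B : Ty
  B = FinTy n

  Realises : (A : Ty) → Tm ∅ (A [ B ]ᵀ) → ⟦ A ⟧ n → Set
  Realises o       u q = u ≈βη finTm q
  Realises (A ⇒ C) u f = ∀ v a → Realises A v a → Realises C (app u v) (f a)
  Realises (A ⊗ C) u p = Realises A (fst u) (proj₁ p) × Realises C (snd u) (proj₂ p)
  Realises 𝟙       _ _ = ⊤

  Realises-≈βη : ∀ A {u u' a} → Realises A u a → u ≈βη u' → Realises A u' a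
  Realises-≈βη o       r         p = ≈trans (≈sym p) r
  Realises-≈βη (A ⇒ C) r         p v a ra = Realises-≈βη C (r v a ra) (≈app p ≈refl)
  Realises-≈βη (A ⊗ C) (r₁ , r₂) p = Realises-≈βη A r₁ (≈fst p) , Realises-≈βη C r₂ (≈snd p)
  Realises-≈βη 𝟙       r         p = tt

  fundamental : (t : Tm Γ A) (σ : Sub (Γ [ B ]ᶜ) ∅) (γ : ⟦ Γ ⟧ᶜ n) →
                (∀ {A'} (x : Var Γ A') → Realises A' (σ (x [ B ]ⱽ)) (lookupV x γ)) →
                Realises A (sub σ (t [ B ]ᵗ)) (eval t γ)
  fundamental (var x) σ γ h = h x
  fundamental {Γ = Γ} (lam {A = A} {B = C} t) σ γ h v a rv =
    Realises-≈βη C (fundamental t (extS σ v) (γ , a) h↑)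
      (≈sym (≈trans (β⇒ _ v) (≡⇒≈βη (sub0-liftS σ (t [ B ]ᵗ) v))))
    where
    h↑ : ∀ {A'} (x : Var (Γ ▸ A) A') → Realises A' (extS σ v (x [ B ]ⱽ)) (lookupV x (γ , a))
    h↑ vz     = rv
    h↑ (vs x) = h x
  fundamental (app t u) σ γ h = fundamental t σ γ h _ _ (fundamental u σ γ h)
  fundamental {A = A ⊗ C} (pair t u) σ γ h =
    Realises-≈βη A (fundamental t σ γ h) (≈sym (β⊗₁ _ _)) ,
    Realises-≈βη C (fundamental u σ γ h) (≈sym (β⊗₂ _ _))
  fundamental (fst t) σ γ h = proj₁ (fundamental t σ γ h)
  fundamental (snd t) σ γ h = proj₂ (fundamental t σ γ h)
  fundamental unit    σ γ h = tt

  fundamental-closed : (t : Tm ∅ A) → Realises A (t [ B ]ᵗ) (⟦ t ⟧ᵗ n)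
  fundamental-closed {A = A} t =
    subst (λ u → Realises A u (⟦ t ⟧ᵗ n)) (sub-var (t [ B ]ᵗ)) (fundamental t var tt (λ ()))

  tabTmᴮ : (Fin k → Tm Γ B) → Tm Γ (Tup o k [ B ]ᵀ)
  tabTmᴮ {k = zero}  f = unit
  tabTmᴮ {k = suc k} f = pair (f zero) (tabTmᴮ (λ i → f (suc i)))

  ren-tabTmᴮ-finTm : (ρ : Ren Γ Δ) (g : Fin k → Fin n) →
                     ren ρ (tabTmᴮ (λ i → finTm (g i))) ≡ tabTmᴮ (λ i → finTm (g i))
  ren-tabTmᴮ-finTm {k = zero}  ρ g = refl
  ren-tabTmᴮ-finTm {k = suc k} ρ g = cong₂ pair (ren-finTm ρ (g zero)) (ren-tabTmᴮ-finTm ρ (λ i → g (suc i)))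

  Realises-tabTmᴮ : ∀ k (g : Fin k → Fin n) → Realises (Tup o k) (tabTmᴮ (λ i → finTm (g i))) (tabulate g)
  Realises-tabTmᴮ zero    g = tt
  Realises-tabTmᴮ (suc k) g =
    β⊗₁ _ _ , Realises-≈βη (Tup o k) (Realises-tabTmᴮ k (λ i → g (suc i))) (≈sym (β⊗₂ _ _))

  Realises-Tup-≈βη : ∀ k us (w : ⟦ Tup o k ⟧ n) → Realises (Tup o k) us w →
                     us ≈βη tabTmᴮ (λ i → finTm (select i w))
  Realises-Tup-≈βη zero    us w       r         = η𝟙 us
  Realises-Tup-≈βη (suc k) us (_ , w) (r₁ , r₂) =
    ≈trans (η⊗ us) (≈pair r₁ (Realises-Tup-≈βη k (snd us) w r₂))

  mapAppᴮ : Tm Γ (Tup o k [ B ]ᵀ) → Tm Γ (Tup o n) → Tm Γ (Tup o k)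
  mapAppᴮ {k = zero}  us v = unit
  mapAppᴮ {k = suc k} us v = pair (app (fst us) v) (mapAppᴮ (snd us) v)

  sub-mapAppᴮ : (σ : Sub Γ Δ) (us : Tm Γ (Tup o k [ B ]ᵀ)) (v : Tm Γ (Tup o n)) →
                sub σ (mapAppᴮ us v) ≡ mapAppᴮ (sub σ us) (sub σ v)
  sub-mapAppᴮ {k = zero}  σ us v = refl
  sub-mapAppᴮ {k = suc k} σ us v = cong (pair _) (sub-mapAppᴮ σ (snd us) v)

  mapAppᴮ-cong : {us us' : Tm Γ (Tup o k [ B ]ᵀ)} (v : Tm Γ (Tup o n)) →
                 us ≈βη us' → mapAppᴮ us v ≈βη mapAppᴮ us' v
  mapAppᴮ-cong {k = zero}  v p = ≈refl
  mapAppᴮ-cong {k = suc k} v p = ≈pair (≈app (≈fst p) ≈refl) (mapAppᴮ-cong v (≈snd p))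

  selTm-mapAppᴮ : (i : Fin k) (g : Fin k → Fin n) (v : Tm Γ (Tup o n)) →
                  selTm i (mapAppᴮ (tabTmᴮ (λ i → finTm (g i))) v) ≈βη app (finTm (g i)) v
  selTm-mapAppᴮ zero    g v = ≈trans (β⊗₁ _ _) (≈app (β⊗₁ _ _) ≈refl)
  selTm-mapAppᴮ (suc i) g v =
    ≈trans (selTm-cong i (≈trans (β⊗₂ _ _) (mapAppᴮ-cong v (β⊗₂ _ _))))
           (selTm-mapAppᴮ i (λ i → g (suc i)) v)

  caseᴮ : Tm ∅ ((o ⇒ FinTy n) [ B ]ᵀ)
  caseᴮ = lam (lam (lam (app (var (vs (vs vz))) (mapAppᴮ (var (vs vz)) (var vz)))))

  caseᴮ-β : (q : Fin n) (g : Fin n → Fin n) →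
            app (app caseᴮ (finTm q)) (tabTmᴮ (λ i → finTm (g i))) ≈βη finTm (g q)
  caseᴮ-β q g =
    ≈trans (≈app (≈trans (β-extS _ (finTm q)) (≡⇒≈βη bind-q)) ≈refl)
    (≈trans (β-extS _ _) (≈trans (≡⇒≈βη bind-us)
    (≈trans (≈lam (≈trans (finTm-β q _) (selTm-mapAppᴮ q g (var vz))))
    (≈sym (≈trans (η⇒ (finTm (g q))) (≡⇒≈βη (cong (λ u → lam (app u (var vz))) (ren-finTm vs (g q)))))))))
    where
    us : Tm Γ (Tup o n [ B ]ᵀ)
    us = tabTmᴮ (λ i → finTm (g i))
    bind-q : sub (extS var (finTm q)) (lam (lam (app (var (vs (vs vz))) (mapAppᴮ (var (vs vz)) (var vz)))))
             ≡ lam (lam (app (finTm q) (mapAppᴮ (var (vs vz)) (var vz))))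
    bind-q = cong lam (cong lam (cong₂ app
               (trans (cong wk (ren-finTm vs q)) (ren-finTm vs q))
               (sub-mapAppᴮ _ (var (vs vz)) (var vz))))
    bind-us : sub (extS var us) (lam (app (finTm q) (mapAppᴮ (var (vs vz)) (var vz))))
              ≡ lam (app (finTm q) (mapAppᴮ us (var vz)))
    bind-us = cong lam (cong₂ app (sub-finTm _ q)
                (trans (sub-mapAppᴮ _ (var (vs vz)) (var vz))
                       (cong (λ u → mapAppᴮ u (var vz)) (ren-tabTmᴮ-finTm vs g))))

  Realises-caseᴮ : Realises (o ⇒ FinTy n) caseᴮ select
  Realises-caseᴮ v q rv us w rus =
    ≈trans (≈app (≈app ≈refl rv) (Realises-Tup-≈βη n us w rus)) (caseᴮ-β q (λ i → select i w))

CharacteristicTerm : (A : Ty) (n : ℕ) → (⟦ A ⟧ n → Bool) → Set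
CharacteristicTerm A n F = Σ Ty λ B → Σ (Tm ∅ (A [ B ]ᵀ ⇒ BoolTy)) λ r →
  (t : Tm ∅ A) → app r (t [ B ]ᵗ) ≈βη boolTm (F (⟦ t ⟧ᵗ n))

Dec-fromFin : {X : Set} → (Fin k → X) → (X → Fin k) → Dec X
Dec-fromFin {k = zero}  f g = no (λ x → ¬Fin0 (g x))
Dec-fromFin {k = suc k} f g = yes (f zero)

constant-characteristicTerm : ∀ {n} (F : ⟦ A ⟧ n → Bool) → (∀ x y → F x ≡ F y) → Dec (⟦ A ⟧ n) →
                              CharacteristicTerm A n F
constant-characteristicTerm F F-const (yes x) =
  o , lam (wk (boolTm (F x))) , λ t → ≈trans (β-wk _ _) (≡⇒≈βη (cong boolTm (F-const x _)))
constant-characteristicTerm {n = n} F F-const (no ¬x) =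
  o , lam (wk trueTm) , λ t → ⊥-elim (¬x (⟦ t ⟧ᵗ n))

module Characteristic (n' : ℕ) (A : Ty) (F : ⟦ A ⟧ (suc (suc n')) → Bool)
                      (F-resp : ∀ x y → SemEq A x y → F x ≡ F y) where
  n : ℕ
  n = suc (suc n')

  open Model n
  open Realisability n

  fromBool : Bool → Fin n
  fromBool true  = zero
  fromBool false = suc zero

  -- χ defines F in the model, with the elements of Q and the case distinction on o as variables.
  Γχ : Ctx
  Γχ = ∅ ▸ Tup o n ▸ (o ⇒ FinTy n) ▸ A

  elementsVar : Tm Γχ (Tup o n)
  elementsVar = var (vs (vs vz))

  χ : Tm Γχ o
  χ = app (indexTm A elementsVar (var (vs vz)) (var vz))
          (tabTm (λ i → selTm (fromBool (F (enum A i))) elementsVar))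

  envχ : ⟦ A ⟧ n → ⟦ Γχ ⟧ᶜ n
  envχ a = ((tt , tabulate (λ i → i)) , select) , a

  eval-χ : ∀ a → SemEq A a a → eval χ (envχ a) ≡ fromBool (F a)
  eval-χ a ha = begin
    eval χ (envχ a)
      ≡⟨ indexTm-codes A _ _ (select-tabulate (λ i → i)) (λ _ _ → refl) (var vz) ha _ ⟩
    select (index A a) (eval (tabTm (λ i → selTm (fromBool (F (enum A i))) elementsVar)) (envχ a))
      ≡⟨ select-eval-tabTm _ (index A a) (envχ a) ⟩
    eval (selTm (fromBool (F (enum A (index A a)))) elementsVar) (envχ a)
      ≡⟨ eval-selTm (fromBool (F (enum A (index A a)))) elementsVar (envχ a) ⟩
    select (fromBool (F (enum A (index A a)))) (tabulate (λ i → i))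
      ≡⟨ select-tabulate (λ i → i) _ ⟩
    fromBool (F (enum A (index A a)))
      ≡⟨ cong fromBool (F-resp _ _ (enum-index A ha)) ⟨
    fromBool (F a) ∎
    where open ≡-Reasoning

  M : Tm ∅ (A [ B ]ᵀ ⇒ B)
  M = app (app (lam (lam (lam χ)) [ B ]ᵗ) (tabTmᴮ finTm)) caseᴮ

  M-computes : (t : Tm ∅ A) → app M (t [ B ]ᵗ) ≈βη finTm (fromBool (F (⟦ t ⟧ᵗ n)))
  M-computes t =
    ≈trans (fundamental-closed (lam (lam (lam χ))) _ _ (Realises-tabTmᴮ n (λ i → i))
                                                  _ _ Realises-caseᴮ _ _ (fundamental-closed t))
           (≡⇒≈βη (cong finTm (eval-χ _ (eval-SemEq t tt tt (λ ())))))

  -- Applying the code of q to (x₁, x₂, …, x₂) selects x₁ for q = 0 and x₂ for q = 1.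
  spread : Tm Γ (o ⊗ o) → Tm Γ (Tup o n)
  spread x = pair (fst x) (tabTm (λ _ → snd x))

  toBool : Tm ∅ (B ⇒ BoolTy)
  toBool = lam (lam (app (var (vs vz)) (spread (var vz))))

  toBool-finTm : (q : Fin n) → app toBool (finTm q) ≈βη lam (selTm q (spread (var vz)))
  toBool-finTm q = ≈trans (β-extS _ (finTm q)) (≈trans (≡⇒≈βη bind-q) (≈lam (finTm-β q _)))
    where
    bind-q : sub (extS var (finTm q)) (lam (app (var (vs vz)) (spread (var vz))))
             ≡ lam (app (finTm q) (spread (var vz)))
    bind-q = cong lam (cong₂ app (ren-finTm vs q) (cong (pair _) (sub-tabTm _ (λ _ → snd (var vz)))))

  toBool-fromBool : (b : Bool) → app toBool (finTm (fromBool b)) ≈βη boolTm b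
  toBool-fromBool true  = ≈trans (toBool-finTm zero) (≈lam (β⊗₁ _ _))
  toBool-fromBool false = ≈trans (toBool-finTm (suc zero)) (≈lam (≈trans (≈fst (β⊗₂ _ _)) (β⊗₁ _ _)))

  r : Tm ∅ (A [ B ]ᵀ ⇒ BoolTy)
  r = lam (app (wk toBool) (app (wk M) (var vz)))

  r-β : (u : Tm ∅ (A [ B ]ᵀ)) → app r u ≈βη app toBool (app M u)
  r-β u = ≈trans (β-extS _ u)
    (≡⇒≈βη (cong₂ app (sub-extS-wk toBool u) (cong (λ m → app m u) (sub-extS-wk M u))))

  characteristicTerm : CharacteristicTerm A n F
  characteristicTerm = B , r , λ t →
    ≈trans (r-β _) (≈trans (≈app ≈refl (M-computes t)) (toBool-fromBool _))

characteristicTerm : (A : Ty) (n : ℕ) (F : ⟦ A ⟧ n → Bool) →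
                     (∀ x y → SemEq A x y → F x ≡ F y) → CharacteristicTerm A n F
characteristicTerm A zero F F-resp =
  constant-characteristicTerm F (λ x y → F-resp x y (SemEq-subsingleton (λ ()) A x y))
    (Dec-fromFin (Model.enum 0 A) (Model.index 0 A))
characteristicTerm A (suc zero) F F-resp =
  constant-characteristicTerm F (λ x y → F-resp x y (SemEq-subsingleton (λ { zero zero → refl }) A x y))
    (Dec-fromFin (Model.enum 1 A) (Model.index 1 A))
characteristicTerm A (suc (suc n')) F F-resp = Characteristic.characteristicTerm n' A F F-resp

theorem6p5 : (A : Ty) (n : ℕ) (F : ⟦ A ⟧ n → Bool) →
    (∀ x y → SemEq A x y → F x ≡ F y) →
    Σ Ty (λ B → Σ (Tm ∅ (A [ B ]ᵀ ⇒ BoolTy)) (λ r →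
    (t : Tm ∅ A) → (F (⟦ t ⟧ᵗ n) ≡ true) ⇔ (app r (t [ B ]ᵗ) ≈βη trueTm)))
theorem6p5 A n F F-resp =
  let (B , r , r-computes) = characteristicTerm A n F F-resp
  in B , r , λ t → ≡true⇔≈βη-trueTm _ (r-computes t)
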